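{- Let $G$ be a graph and $e\in E(G)$ an edge such that $G-e$ is a planar bipartite graph with bipartition $A,B$ satisfying $|B|\le|A|\le|B|+1$, where both endpoints of $e$ lie in $A$. Then there exists a vertex $v\in A$ such that $\deg_G(v)\le 3$.
   Context: All graphs are finite, undirected and simple. A bipartition $A,B$ of a bipartite graph is a partition of its vertex set into two disjoint independent sets $A$ and $B$. $G-e$ denotes the graph obtained from $G$ by deleting the edge $e$ (keeping all vertices); $\deg_G(v)$ is the degree of $v$ in $G$. -}

module Defs where

open import Data.Nat using (ℕ; zero; suc; _+_; _*_; _≤_; _≤ᵇ_)
open import Data.Fin using (Fin; zero; suc; toℕ; _≟_)
open import Data.Bool using (Bool; true; false; _∧_; _∨_; not; if_then_else_)
open import Data.Product using (Σ; _×_; _,_)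
open import Relation.Nullary using (¬_)
open import Relation.Nullary.Decidable using (⌊_⌋)
open import Relation.Binary.PropositionalEquality using (_≡_; _≢_)
open import Function.Definitions using (Injective)

count : ∀ {n} → (Fin n → Bool) → ℕ
count {zero}  f = 0
count {suc n} f = (if f zero then 1 else 0) + count (λ i → f (suc i))

allFin : ∀ {n} → (Fin n → Bool) → Bool
allFin {zero}  f = true
allFin {suc n} f = f zero ∧ allFin (λ i → f (suc i))

iter : ∀ {A : Set} → (A → A) → ℕ → A → A
iter f zero    x = x
iter f (suc k) x = f (iter f k x)

record Graph (n : ℕ) : Set where
  field
    adj    : Fin n → Fin n → Bool
    sym    : ∀ u v → adj u v ≡ adj v u
    irrefl : ∀ v → adj v v ≡ false
open Graph public

deg : ∀ {n} → Graph n → Fin n → ℕ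
deg G v = count (adj G v)

isPair : ∀ {n} → Fin n → Fin n → Fin n → Fin n → Bool
isPair x y u v = (⌊ u ≟ x ⌋ ∧ ⌊ v ≟ y ⌋) ∨ (⌊ u ≟ y ⌋ ∧ ⌊ v ≟ x ⌋)

deleteEdge : ∀ {n} → Graph n → Fin n → Fin n → Graph n
deleteEdge {n} G x y = record
  { adj    = λ u v → adj G u v ∧ not (isPair x y u v)
  ; sym    = symm
  ; irrefl = irr
  }
  where
  open import Relation.Binary.PropositionalEquality using (cong₂; refl)
  open import Data.Bool.Properties using (∨-comm)
  pairSym : ∀ u v → isPair x y u v ≡ isPair x y v u
  pairSym u v with u ≟ x | v ≟ y | u ≟ y | v ≟ x
  ... | a | b | c | d with ⌊ a ⌋ | ⌊ b ⌋ | ⌊ c ⌋ | ⌊ d ⌋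
  ... | true  | true  | true  | true  = refl
  ... | true  | true  | true  | false = refl
  ... | true  | true  | false | true  = refl
  ... | true  | true  | false | false = refl
  ... | true  | false | true  | true  = refl
  ... | true  | false | true  | false = refl
  ... | true  | false | false | true  = refl
  ... | true  | false | false | false = refl
  ... | false | true  | true  | true  = refl
  ... | false | true  | true  | false = refl
  ... | false | true  | false | true  = refl
  ... | false | true  | false | false = refl
  ... | false | false | true  | true  = refl
  ... | false | false | true  | false = refl
  ... | false | false | false | true  = refl
  ... | false | false | false | false = refl
  symm : ∀ u v → (adj G u v ∧ not (isPair x y u v)) ≡ (adj G v u ∧ not (isPair x y v u))
  symm u v = cong₂ (λ a b → a ∧ not b) (sym G u v) (pairSym u v)
  irr : ∀ v → (adj G v v ∧ not (isPair x y v v)) ≡ false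
  irr v rewrite irrefl G v = refl

-- Planarity via combinatorial maps (rotation systems)
--
-- Darts are Fin d.  α is the edge involution (fixed-point free), σ the
-- rotation at vertices, φ = σ ∘ α the face permutation.  The darts
-- correspond bijectively to the ordered pairs (u , v) with u ~ v, and the
-- darts at each vertex form a single σ-cycle.  The embedding has genus
-- zero on every component iff  #V + #F = #E + 2 #C, where #V, #E, #F are
-- the numbers of σ-, α-, φ-orbits and #C is the number of connected
-- components of the map (orbits of the group ⟨α , σ⟩).

orbitMin : ∀ {d} → (Fin d → Fin d) → Fin d → Bool
orbitMin {d} f x = allFin {d} (λ k → toℕ x ≤ᵇ toℕ (iter f (toℕ k) x))

orbits : ∀ {d} → (Fin d → Fin d) → ℕ
orbits f = count (orbitMin f)

reach : ∀ {d} → (Fin d → Fin d) → (Fin d → Fin d) → ℕ → Fin d → Fin d → Bool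
reach α σ zero    x y = ⌊ x ≟ y ⌋
reach α σ (suc k) x y = reach α σ k x y ∨ reach α σ k (α x) y ∨ reach α σ k (σ x) y

components : ∀ {d} → (Fin d → Fin d) → (Fin d → Fin d) → ℕ
components {d} α σ =
  count (λ x → allFin (λ y → not (reach α σ d y x) ∨ (toℕ x ≤ᵇ toℕ y)))

record PlanarMap {n : ℕ} (G : Graph n) : Set where
  field
    d       : ℕ
    tail    : Fin d → Fin n
    α       : Fin d → Fin d
    σ       : Fin d → Fin d
    α-invol : ∀ x → α (α x) ≡ x
    α-free  : ∀ x → α x ≢ x
    σ-inj   : Injective _≡_ _≡_ σ
    σ-tail  : ∀ x → tail (σ x) ≡ tail x
    σ-trans : ∀ x y → tail x ≡ tail y → Σ ℕ (λ k → iter σ k x ≡ y)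
    dart-edge : ∀ x → adj G (tail x) (tail (α x)) ≡ true
    dart-inj  : ∀ x y → tail x ≡ tail y → tail (α x) ≡ tail (α y) → x ≡ y
    dart-surj : ∀ u v → adj G u v ≡ true →
                Σ (Fin d) (λ x → (tail x ≡ u) × (tail (α x) ≡ v))
    euler   : orbits σ + orbits (λ x → σ (α x)) ≡ orbits α + 2 * components α σ

Planar : ∀ {n} → Graph n → Set
Planar G = PlanarMap G

IsBipartition : ∀ {n} → Graph n → (Fin n → Bool) → Set
IsBipartition H inA = ∀ u v → inA u ≡ inA v → adj H u v ≡ false

-- Suppose every vertex of A has degree at least 4 in G.  Deleting e costs each vertex at most
-- one neighbour, so in H = G - e every vertex of A has degree at least 2, and the degree sum
-- over A, which counts every edge of H exactly once, is E ≥ 4|A| - 2.  In a plane map of H with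
-- V ≤ |A| + |B| ≤ 2|A| vertices, F faces and C ≥ 1 components every face has length at least 4:
-- odd lengths are excluded by the bipartition, and a face of length 2 surrounds an isolated
-- edge, one end of which would be a vertex of A of degree 1.  Hence 4F ≤ 2E, and Euler's
-- formula V + F = E + 2C gives 4E + 8 ≤ 4V + 4F ≤ 8|A| + 2E ≤ 4E + 4.

{-# OPTIONS --safe #-}
module Submission where

open import Defs hiding (sym)
open import Data.Nat using (ℕ; _≤_; _+_)
open import Data.Fin using (Fin)
open import Data.Bool using (Bool; true; not)
open import Data.Product using (Σ; _×_)
open import Relation.Binary.PropositionalEquality using (_≡_)

open import Data.Bool using (false; _∧_; _∨_; if_then_else_)
import Data.Bool.Properties as Bool
open import Data.Empty using (⊥; ⊥-elim)
open import Data.Fin using (zero; suc; toℕ; _≟_; fromℕ<)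
open import Data.Fin.Properties
  using (any?; suc-injective; 0≢1+n; pigeonhole; toℕ<n; toℕ≤pred[n]; toℕ-fromℕ<; toℕ-injective)
open import Data.Nat using (zero; suc; _*_; _∸_; _<_; z≤n; s≤s; _≤ᵇ_; _≤?_)
open import Data.Nat.DivMod using (_%_; _/_; m≡m%n+[m/n]*n; m%n<n)
open import Data.Nat.Properties
  using ( +-0-commutativeMonoid; module ≤-Reasoning
        ; ≤-refl; ≤-reflexive; ≤-trans; ≤-antisym; <⇒≤; ≤-<-trans; <-≤-trans; <-cmp; ≰⇒>; ≤⇒≯
        ; ≤ᵇ⇒≤; ≤⇒≤ᵇ; +-comm; +-suc; m≤m+n; m≤n+m; +-mono-≤; +-monoˡ-≤; +-monoʳ-≤
        ; +-cancelˡ-≤; +-cancelʳ-≤; *-suc; *-zeroʳ; *-identityʳ; *-distribˡ-+; *-monoʳ-≤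
        ; m∸n≤m; m∸n+n≡m; m+[n∸m]≡n; m<n⇒0<n∸m)
open import Algebra.Properties.CommutativeMonoid.Sum +-0-commutativeMonoid
  using (sum; ∑-distrib-+; sum-replicate-zero)
open import Data.Nat.Tactic.RingSolver using (solve-∀)
open import Data.Product using (∃; _,_; proj₁; proj₂; map₁)
open import Data.Sum using (_⊎_; inj₁; inj₂)
open import Function.Base using (_∘_)
open import Function.Bundles using (Equivalence)
open import Function.Definitions using (Injective)
open import Relation.Binary.Definitions using (tri<; tri≈; tri>)
open import Relation.Binary.PropositionalEquality
  using (_≢_; _≗_; refl; sym; trans; cong; cong₂; subst; module ≡-Reasoning)
open import Relation.Nullary using (Dec; yes; no; ¬_)
open import Relation.Nullary.Decidable
  using (⌊_⌋; _×-dec_; isYes≗does; dec-true; dec-false; ⌊⌋-map′)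

-- Counting over Fin n

⌊⌋-true : ∀ {A : Set} (a? : Dec A) → A → ⌊ a? ⌋ ≡ true
⌊⌋-true a? a = trans (isYes≗does a?) (dec-true a? a)

not⌊⌋-true : ∀ {A : Set} (a? : Dec A) → ¬ A → not ⌊ a? ⌋ ≡ true
not⌊⌋-true a? ¬a = cong not (trans (isYes≗does a?) (dec-false a? ¬a))

𝟙 : Bool → ℕ
𝟙 b = if b then 1 else 0

count-≗ : ∀ {n} {f g : Fin n → Bool} → f ≗ g → count f ≡ count g
count-≗ {zero}  f≗g = refl
count-≗ {suc n} f≗g = cong₂ _+_ (cong 𝟙 (f≗g zero)) (count-≗ (f≗g ∘ suc))

count-false : ∀ {n} → count {n} (λ _ → false) ≡ 0
count-false {zero}  = refl
count-false {suc n} = count-false {n}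

count-true : ∀ {n} → count {n} (λ _ → true) ≡ n
count-true {zero}  = refl
count-true {suc n} = cong suc (count-true {n})

𝟙≤1 : ∀ b → 𝟙 b ≤ 1
𝟙≤1 true  = ≤-refl
𝟙≤1 false = z≤n

count-≟ : ∀ {n} (k : Fin n) → count (λ i → ⌊ i ≟ k ⌋) ≡ 1
count-≟ {suc n} zero    = cong suc (count-false {n})
count-≟ {suc n} (suc k) =
  trans (count-≗ (λ i → ⌊⌋-map′ _ _ (i ≟ k))) (count-≟ k)

count-∧-≟ : ∀ {n} b (k : Fin n) → count (λ i → b ∧ ⌊ i ≟ k ⌋) ≡ 𝟙 b
count-∧-≟ {n} true  k = count-≟ k
count-∧-≟ {n} false k = count-false {n}

count-pos : ∀ {n} (f : Fin n → Bool) {k} → f k ≡ true → 1 ≤ count f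
count-pos f {zero}  fk rewrite fk = s≤s z≤n
count-pos f {suc k} fk = ≤-trans (count-pos (f ∘ suc) fk) (m≤n+m _ (𝟙 (f zero)))

count-complement : ∀ {n} (f : Fin n → Bool) → count f + count (not ∘ f) ≡ n
count-complement {zero}  f = refl
count-complement {suc n} f with f zero
... | true  = cong suc (count-complement (f ∘ suc))
... | false = trans (+-suc _ _) (cong suc (count-complement (f ∘ suc)))

count≤n : ∀ {n} (f : Fin n → Bool) → count f ≤ n
count≤n f = ≤-trans (m≤m+n (count f) _) (≤-reflexive (count-complement f))

count-split : ∀ {n} (f g : Fin n → Bool) →
              count f ≡ count (λ i → f i ∧ g i) + count (λ i → f i ∧ not (g i))
count-split {zero}  f g = refl
count-split {suc n} f g with f zero | g zero
... | true  | true  = cong suc (count-split (f ∘ suc) (g ∘ suc))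
... | true  | false = trans (cong suc (count-split (f ∘ suc) (g ∘ suc))) (sym (+-suc _ _))
... | false | _     = count-split (f ∘ suc) (g ∘ suc)

count-∨ : ∀ {n} (f g : Fin n → Bool) → count (λ i → f i ∨ g i) ≤ count f + count g
count-∨ {zero}  f g = z≤n
count-∨ {suc n} f g with f zero | g zero
... | true  | g₀    = s≤s (≤-trans (count-∨ (f ∘ suc) (g ∘ suc)) (+-monoʳ-≤ (count (f ∘ suc)) (m≤n+m _ (𝟙 g₀))))
... | false | true  = ≤-trans (s≤s (count-∨ (f ∘ suc) (g ∘ suc))) (≤-reflexive (sym (+-suc _ _)))
... | false | false = count-∨ (f ∘ suc) (g ∘ suc)

count-≤-injective : ∀ {n m} (P : Fin n → Bool) (Q : Fin m → Bool)
                    (h : ∀ i → P i ≡ true → Fin m) →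
                    (∀ i p → Q (h i p) ≡ true) →
                    (∀ {i i'} p p' → h i p ≡ h i' p' → i ≡ i') →
                    count P ≤ count Q
count-≤-injective {zero}  P Q h h∈Q h-inj = z≤n
count-≤-injective {suc n} P Q h h∈Q h-inj with P zero in p₀
... | false = count-≤-injective (P ∘ suc) Q (h ∘ suc) (h∈Q ∘ suc) (λ p p' → suc-injective ∘ h-inj p p')
... | true  = begin
  suc (count (P ∘ suc))
    ≤⟨ +-mono-≤ (count-pos (λ j → Q j ∧ ⌊ j ≟ k ⌋) {k} k∈Q)
                (count-≤-injective (P ∘ suc) _ (h ∘ suc) h∈Q′ (λ p p' → suc-injective ∘ h-inj p p')) ⟩
  count (λ j → Q j ∧ ⌊ j ≟ k ⌋) + count (λ j → Q j ∧ not ⌊ j ≟ k ⌋)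
    ≡⟨ sym (count-split Q (λ j → ⌊ j ≟ k ⌋)) ⟩
  count Q ∎
  where
  open ≤-Reasoning
  k = h zero p₀
  k∈Q : (Q k ∧ ⌊ k ≟ k ⌋) ≡ true
  k∈Q = cong₂ _∧_ (h∈Q zero p₀) (⌊⌋-true (k ≟ k) refl)
  h∈Q′ : ∀ i p → (Q (h (suc i) p) ∧ not ⌊ h (suc i) p ≟ k ⌋) ≡ true
  h∈Q′ i p = cong₂ _∧_ (h∈Q (suc i) p) (not⌊⌋-true (_ ≟ k) (λ e → 0≢1+n (sym (h-inj p p₀ e))))

count-mono : ∀ {n} (f g : Fin n → Bool) → (∀ i → f i ≡ true → g i ≡ true) → count f ≤ count g
count-mono f g f⇒g = count-≤-injective f g (λ i _ → i) f⇒g (λ _ _ e → e)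

image : ∀ {n m} → (Fin n → Bool) → (Fin n → Fin m) → Fin m → Bool
image P h q = ⌊ any? (λ i → (P i Bool.≟ true) ×-dec (h i ≟ q)) ⌋

*-count-≤-injective : ∀ {n m} k (P : Fin n → Bool) (Q : Fin m → Bool) (h : Fin k → Fin n → Fin m) →
                      (∀ j i → P i ≡ true → Q (h j i) ≡ true) →
                      (∀ {j j' i i'} → P i ≡ true → P i' ≡ true → h j i ≡ h j' i' → j ≡ j' × i ≡ i') →
                      k * count P ≤ count Q
*-count-≤-injective zero    P Q h h∈Q h-inj = z≤n
*-count-≤-injective (suc k) P Q h h∈Q h-inj = begin
  count P + k * count P
    ≤⟨ +-mono-≤ (count-≤-injective P _ (λ i _ → h zero i) h₀∈Q (λ p p' → proj₂ ∘ h-inj p p'))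
                (*-count-≤-injective k P _ (h ∘ suc) hₛ∈Q (λ p p' → map₁ suc-injective ∘ h-inj p p')) ⟩
  count (λ q → Q q ∧ image P (h zero) q) + count (λ q → Q q ∧ not (image P (h zero) q))
    ≡⟨ sym (count-split Q (image P (h zero))) ⟩
  count Q ∎
  where
  open ≤-Reasoning
  h₀∈Q : ∀ i → P i ≡ true → (Q (h zero i) ∧ image P (h zero) (h zero i)) ≡ true
  h₀∈Q i p = cong₂ _∧_ (h∈Q zero i p) (⌊⌋-true (any? _) (i , p , refl))
  hₛ∈Q : ∀ j i → P i ≡ true → (Q (h (suc j) i) ∧ not (image P (h zero) (h (suc j) i))) ≡ true
  hₛ∈Q j i p = cong₂ _∧_ (h∈Q (suc j) i p)
                         (not⌊⌋-true (any? _) (λ (i' , p' , e) → 0≢1+n (proj₁ (h-inj p' p e))))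

-- Sums over Fin n

sum-mono-≤ : ∀ {n} (f g : Fin n → ℕ) → (∀ i → f i ≤ g i) → sum f ≤ sum g
sum-mono-≤ {zero}  f g f≤g = z≤n
sum-mono-≤ {suc n} f g f≤g = +-mono-≤ (f≤g zero) (sum-mono-≤ (f ∘ suc) (g ∘ suc) (f≤g ∘ suc))

count≡sum : ∀ {n} (f : Fin n → Bool) → count f ≡ sum (𝟙 ∘ f)
count≡sum {zero}  f = refl
count≡sum {suc n} f = cong (𝟙 (f zero) +_) (count≡sum (f ∘ suc))

*-count≤sum : ∀ {n} k (P : Fin n → Bool) (g : Fin n → ℕ) → (∀ u → P u ≡ true → k ≤ g u) →
              k * count P ≤ sum (λ u → if P u then g u else 0)
*-count≤sum {zero}  k P g k≤g = ≤-reflexive (*-zeroʳ k)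
*-count≤sum {suc n} k P g k≤g = begin
  k * (𝟙 (P zero) + count (P ∘ suc))      ≡⟨ *-distribˡ-+ k (𝟙 (P zero)) _ ⟩
  k * 𝟙 (P zero) + k * count (P ∘ suc)    ≤⟨ +-mono-≤ head (*-count≤sum k (P ∘ suc) (g ∘ suc) (k≤g ∘ suc)) ⟩
  sum (λ u → if P u then g u else 0)      ∎
  where
  open ≤-Reasoning
  head : k * 𝟙 (P zero) ≤ (if P zero then g zero else 0)
  head with P zero in p₀
  ... | true  = ≤-trans (≤-reflexive (*-identityʳ k)) (k≤g zero p₀)
  ... | false = ≤-reflexive (*-zeroʳ k)

sum-𝟙-∧-≟ : ∀ {n} b (k : Fin n) → sum (λ u → 𝟙 (b ∧ ⌊ u ≟ k ⌋)) ≡ 𝟙 b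
sum-𝟙-∧-≟ b k = trans (sym (count≡sum (λ u → b ∧ ⌊ u ≟ k ⌋))) (count-∧-≟ b k)

count-fibres : ∀ {d n} (P : Fin d → Bool) (t : Fin d → Fin n) →
               count P ≡ sum (λ u → count (λ z → P z ∧ ⌊ u ≟ t z ⌋))
count-fibres {zero}  {n} P t = sym (sum-replicate-zero n)
count-fibres {suc d}     P t = begin
  𝟙 (P zero) + count (P ∘ suc)
    ≡⟨ cong₂ _+_ (sym (sum-𝟙-∧-≟ (P zero) (t zero))) (count-fibres (P ∘ suc) (t ∘ suc)) ⟩
  sum (λ u → 𝟙 (P zero ∧ ⌊ u ≟ t zero ⌋)) + sum (λ u → count (λ z → P (suc z) ∧ ⌊ u ≟ t (suc z) ⌋))
    ≡⟨ sym (∑-distrib-+ (λ u → 𝟙 (P zero ∧ ⌊ u ≟ t zero ⌋)) (λ u → count (λ z → P (suc z) ∧ ⌊ u ≟ t (suc z) ⌋))) ⟩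
  sum (λ u → count (λ z → P z ∧ ⌊ u ≟ t z ⌋)) ∎
  where open ≡-Reasoning

-- Orbits of maps on Fin d

allFin-true : ∀ {n} {g : Fin n → Bool} → (∀ i → g i ≡ true) → allFin g ≡ true
allFin-true {zero}  g≡true = refl
allFin-true {suc n} g≡true = cong₂ _∧_ (g≡true zero) (allFin-true (g≡true ∘ suc))

allFin-true⁻¹ : ∀ {n} (g : Fin n → Bool) → allFin g ≡ true → ∀ i → g i ≡ true
allFin-true⁻¹ {suc n} g all i with g zero in g₀
allFin-true⁻¹ {suc n} g all zero    | true = g₀
allFin-true⁻¹ {suc n} g all (suc i) | true = allFin-true⁻¹ (g ∘ suc) all i

≤ᵇ-true : ∀ {m n} → m ≤ n → (m ≤ᵇ n) ≡ true
≤ᵇ-true m≤n = Equivalence.to Bool.T-≡ (≤⇒≤ᵇ m≤n)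

≤ᵇ-true⁻¹ : ∀ {m n} → (m ≤ᵇ n) ≡ true → m ≤ n
≤ᵇ-true⁻¹ {m} {n} e = ≤ᵇ⇒≤ m n (Equivalence.from Bool.T-≡ e)

iter-+ : ∀ {A : Set} (f : A → A) a b x → iter f (a + b) x ≡ iter f a (iter f b x)
iter-+ f zero    b x = refl
iter-+ f (suc a) b x = cong f (iter-+ f a b x)

iter-periodic : ∀ {A : Set} (f : A → A) {p x} → iter f p x ≡ x → ∀ q → iter f (q * p) x ≡ x
iter-periodic f         e zero    = refl
iter-periodic f {p} {x} e (suc q) = begin
  iter f (p + q * p) x      ≡⟨ iter-+ f p (q * p) x ⟩
  iter f p (iter f (q * p) x) ≡⟨ cong (iter f p) (iter-periodic f e q) ⟩
  iter f p x                ≡⟨ e ⟩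
  x                         ∎
  where open ≡-Reasoning

NoShortCycles : ∀ {A : Set} → (A → A) → ℕ → Set
NoShortCycles f k = ∀ c z → 0 < c → c < k → iter f c z ≢ z

iter-<-distinct : ∀ {A : Set} (f : A → A) {k} → NoShortCycles f k →
                  ∀ {i j z} → i < j → j < k → iter f i z ≢ iter f j z
iter-<-distinct f no-cycle {i} {j} {z} i<j j<k e =
  no-cycle (j ∸ i) (iter f i z) (m<n⇒0<n∸m i<j) (≤-<-trans (m∸n≤m j i) j<k) (begin
    iter f (j ∸ i) (iter f i z) ≡⟨ sym (iter-+ f (j ∸ i) i z) ⟩
    iter f (j ∸ i + i) z        ≡⟨ cong (λ c → iter f c z) (m∸n+n≡m (<⇒≤ i<j)) ⟩
    iter f j z                  ≡⟨ sym e ⟩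
    iter f i z                  ∎)
  where open ≡-Reasoning

iter-<-injective : ∀ {A : Set} (f : A → A) {k} → NoShortCycles f k →
                   ∀ {i j z} → i < k → j < k → iter f i z ≡ iter f j z → i ≡ j
iter-<-injective f no-cycle {i} {j} i<k j<k e with <-cmp i j
... | tri< i<j _ _ = ⊥-elim (iter-<-distinct f no-cycle i<j j<k e)
... | tri≈ _ i≡j _ = i≡j
... | tri> _ _ j<i = ⊥-elim (iter-<-distinct f no-cycle j<i i<k (sym e))

module Orbits {d} (f : Fin d → Fin d) (f-injective : Injective _≡_ _≡_ f) where

  iter-injective : ∀ k {x y} → iter f k x ≡ iter f k y → x ≡ y
  iter-injective zero    e = e
  iter-injective (suc k) e = iter-injective k (f-injective e)

  period : ∀ x → ∃ λ p → 0 < p × p ≤ d × iter f p x ≡ x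
  period x with pigeonhole ≤-refl (λ (i : Fin (suc d)) → iter f (toℕ i) x)
  ... | i , j , i<j , fⁱx≡fʲx =
    toℕ j ∸ toℕ i , m<n⇒0<n∸m i<j , ≤-trans (m∸n≤m (toℕ j) (toℕ i)) (toℕ≤pred[n] j) ,
    sym (iter-injective (toℕ i) (begin
      iter f (toℕ i) x                          ≡⟨ fⁱx≡fʲx ⟩
      iter f (toℕ j) x                          ≡⟨ cong (λ k → iter f k x) (sym (m+[n∸m]≡n (<⇒≤ i<j))) ⟩
      iter f (toℕ i + (toℕ j ∸ toℕ i)) x        ≡⟨ iter-+ f (toℕ i) _ x ⟩
      iter f (toℕ i) (iter f (toℕ j ∸ toℕ i) x) ∎))
    where open ≡-Reasoning

  iter-inverse : ∀ k x → ∃ λ j → iter f j (iter f k x) ≡ x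
  iter-inverse k x with period x
  ... | suc p , _ , _ , fᵖx≡x = k * p , (begin
    iter f (k * p) (iter f k x) ≡⟨ sym (iter-+ f (k * p) k x) ⟩
    iter f (k * p + k) x        ≡⟨ cong (λ j → iter f j x) (trans (+-comm (k * p) k) (sym (*-suc k p))) ⟩
    iter f (k * suc p) x        ≡⟨ iter-periodic f fᵖx≡x k ⟩
    x                           ∎)
    where open ≡-Reasoning

  orbitMin-≤ : ∀ {m} → orbitMin f m ≡ true → ∀ k → toℕ m ≤ toℕ (iter f k m)
  orbitMin-≤ {m} min k with period m
  ... | p@(suc _) , _ , p≤d , fᵖm≡m = subst (λ z → toℕ m ≤ toℕ z) (sym fᵏm≡fʳm) (≤ᵇ-true⁻¹ m≤fʳm)
    where
    r<d : k % p < d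
    r<d = <-≤-trans (m%n<n k p) p≤d
    fᵏm≡fʳm : iter f k m ≡ iter f (k % p) m
    fᵏm≡fʳm = begin
      iter f k m                              ≡⟨ cong (λ j → iter f j m) (m≡m%n+[m/n]*n k p) ⟩
      iter f (k % p + k / p * p) m            ≡⟨ iter-+ f (k % p) _ m ⟩
      iter f (k % p) (iter f (k / p * p) m)   ≡⟨ cong (iter f (k % p)) (iter-periodic f fᵖm≡m (k / p)) ⟩
      iter f (k % p) m                        ∎
      where open ≡-Reasoning
    m≤fʳm : (toℕ m ≤ᵇ toℕ (iter f (k % p) m)) ≡ true
    m≤fʳm = subst (λ j → (toℕ m ≤ᵇ toℕ (iter f j m)) ≡ true) (toℕ-fromℕ< r<d)
                  (allFin-true⁻¹ _ min (fromℕ< r<d))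

  orbitMin-unique : ∀ {m m'} k → orbitMin f m ≡ true → orbitMin f m' ≡ true → iter f k m ≡ m' → m ≡ m'
  orbitMin-unique {m} {m'} k min min' fᵏm≡m' with iter-inverse k m
  ... | j , fʲfᵏm≡m = toℕ-injective (≤-antisym
    (subst (λ z → toℕ m ≤ toℕ z) fᵏm≡m' (orbitMin-≤ min k))
    (subst (λ z → toℕ m' ≤ toℕ z) (trans (cong (iter f j) (sym fᵏm≡m')) fʲfᵏm≡m) (orbitMin-≤ min' j)))

  *-orbits≤ : ∀ k → NoShortCycles f k → k * orbits f ≤ d
  *-orbits≤ k no-cycle = ≤-trans
    (*-count-≤-injective k (orbitMin f) (λ _ → true) (λ j m → iter f (toℕ j) m) (λ _ _ _ → refl) injective)
    (≤-reflexive count-true)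
    where
    injective : ∀ {j j' m m'} → orbitMin f m ≡ true → orbitMin f m' ≡ true →
                iter f (toℕ j) m ≡ iter f (toℕ j') m' → j ≡ j' × m ≡ m'
    injective {j} {j'} {m} {m'} min min' e with iter-inverse (toℕ j') m'
    ... | i , fⁱfʲ'm'≡m' with orbitMin-unique (i + toℕ j) min min' (trans (iter-+ f i (toℕ j) m) (trans (cong (iter f i) e) fⁱfʲ'm'≡m'))
    ... | refl = toℕ-injective (iter-<-injective f no-cycle (toℕ<n j) (toℕ<n j') e) , refl

module Involution {d} (α : Fin d → Fin d) (α-involutive : ∀ z → α (α z) ≡ z) where

  iter-α : ∀ k z → iter α k z ≡ z ⊎ iter α k z ≡ α z
  iter-α zero    z = inj₁ refl
  iter-α (suc k) z with iter-α k z
  ... | inj₁ αᵏz≡z  = inj₂ (cong α αᵏz≡z)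
  ... | inj₂ αᵏz≡αz = inj₁ (trans (cong α αᵏz≡αz) (α-involutive z))

  orbitMin-α : ∀ {z} → toℕ z ≤ toℕ (α z) → orbitMin α z ≡ true
  orbitMin-α {z} z≤αz = allFin-true {d} (λ k → ≤ᵇ-true (z≤αᵏz (toℕ k)))
    where
    z≤αᵏz : ∀ k → toℕ z ≤ toℕ (iter α k z)
    z≤αᵏz k with iter-α k z
    ... | inj₁ αᵏz≡z  = ≤-reflexive (cong toℕ (sym αᵏz≡z))
    ... | inj₂ αᵏz≡αz = subst (λ w → toℕ z ≤ toℕ w) (sym αᵏz≡αz) z≤αz

  representative : ∀ z → ∃ λ r → (r ≡ z ⊎ r ≡ α z) × toℕ r ≤ toℕ (α r)
  representative z with toℕ z ≤? toℕ (α z)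
  ... | yes z≤αz = z , inj₁ refl , z≤αz
  ... | no  z≰αz = α z , inj₂ refl , subst (λ w → toℕ (α z) ≤ toℕ w) (sym (α-involutive z)) (<⇒≤ (≰⇒> z≰αz))

  count≤orbits : (P : Fin d → Bool) → (∀ z → P z ≡ true → P (α z) ≡ false) → count P ≤ orbits α
  count≤orbits P P-flips = count-≤-injective P (orbitMin α) (λ z _ → rep z) (λ z _ → orbitMin-α (rep≤αrep z)) injective
    where
    rep : Fin d → Fin d
    rep z = proj₁ (representative z)
    rep≤αrep : ∀ z → toℕ (rep z) ≤ toℕ (α (rep z))
    rep≤αrep z = proj₂ (proj₂ (representative z))
    α-injective : ∀ {z z'} → α z ≡ α z' → z ≡ z'
    α-injective {z} {z'} e = trans (sym (α-involutive z)) (trans (cong α e) (α-involutive z'))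
    not-both : ∀ {z} → P z ≡ true → P (α z) ≡ true → ⊥
    not-both {z} pz pαz with () ← trans (sym (P-flips z pz)) pαz
    injective : ∀ {z z'} → P z ≡ true → P z' ≡ true → rep z ≡ rep z' → z ≡ z'
    injective {z} {z'} pz pz' e with representative z | representative z'
    ... | _ , inj₁ refl , _ | _ , inj₁ refl , _ = e
    ... | _ , inj₁ refl , _ | _ , inj₂ refl , _ = ⊥-elim (not-both pz' (subst (λ w → P w ≡ true) e pz))
    ... | _ , inj₂ refl , _ | _ , inj₁ refl , _ = ⊥-elim (not-both pz (subst (λ w → P w ≡ true) (sym e) pz'))
    ... | _ , inj₂ refl , _ | _ , inj₂ refl , _ = α-injective e

components-pos : ∀ {d} (α σ : Fin d → Fin d) → 0 < d → 0 < components α σ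
components-pos {suc d} α σ _ =
  count-pos (λ x → allFin (λ y → not (reach α σ (suc d) y x) ∨ (toℕ x ≤ᵇ toℕ y))) {zero}
            (allFin-true (λ y → Bool.∨-zeroʳ (not (reach α σ (suc d) y zero))))

-- Degrees and planar maps

degreeSum : ∀ {n} → Graph n → (Fin n → Bool) → ℕ
degreeSum G P = sum (λ u → if P u then deg G u else 0)

module _ {n} (G : Graph n) (x y : Fin n) where

  private
    H = deleteEdge G x y

  deg-deleteEdge : ∀ u → deg G u ≤ deg H u + (𝟙 ⌊ u ≟ x ⌋ + 𝟙 ⌊ u ≟ y ⌋)
  deg-deleteEdge u = begin
    count (adj G u)
      ≤⟨ count-mono (adj G u) _ (λ v → kept-or-deleted (adj G u v) (isPair x y u v)) ⟩
    count (λ v → adj H u v ∨ isPair x y u v)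
      ≤⟨ count-∨ (adj H u) (isPair x y u) ⟩
    deg H u + count (isPair x y u)
      ≤⟨ +-monoʳ-≤ (deg H u) (count-∨ (λ v → ⌊ u ≟ x ⌋ ∧ ⌊ v ≟ y ⌋) (λ v → ⌊ u ≟ y ⌋ ∧ ⌊ v ≟ x ⌋)) ⟩
    deg H u + (count (λ v → ⌊ u ≟ x ⌋ ∧ ⌊ v ≟ y ⌋) + count (λ v → ⌊ u ≟ y ⌋ ∧ ⌊ v ≟ x ⌋))
      ≡⟨ cong (deg H u +_) (cong₂ _+_ (count-∧-≟ ⌊ u ≟ x ⌋ y) (count-∧-≟ ⌊ u ≟ y ⌋ x)) ⟩
    deg H u + (𝟙 ⌊ u ≟ x ⌋ + 𝟙 ⌊ u ≟ y ⌋) ∎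
    where
    open ≤-Reasoning
    kept-or-deleted : ∀ a b → a ≡ true → ((a ∧ not b) ∨ b) ≡ true
    kept-or-deleted true true  refl = refl
    kept-or-deleted true false refl = refl

  deg≤deg-deleteEdge+2 : ∀ u → deg G u ≤ deg H u + 2
  deg≤deg-deleteEdge+2 u =
    ≤-trans (deg-deleteEdge u) (+-monoʳ-≤ (deg H u) (+-mono-≤ (𝟙≤1 ⌊ u ≟ x ⌋) (𝟙≤1 ⌊ u ≟ y ⌋)))

  degreeSum-deleteEdge : ∀ P → degreeSum G P ≤ degreeSum H P + 2
  degreeSum-deleteEdge P = begin
    sum (λ u → if P u then deg G u else 0)
      ≤⟨ sum-mono-≤ _ _ pointwise ⟩
    sum (λ u → (if P u then deg H u else 0) + (𝟙 ⌊ u ≟ x ⌋ + 𝟙 ⌊ u ≟ y ⌋))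
      ≡⟨ ∑-distrib-+ (λ u → if P u then deg H u else 0) (λ u → 𝟙 ⌊ u ≟ x ⌋ + 𝟙 ⌊ u ≟ y ⌋) ⟩
    degreeSum H P + sum (λ u → 𝟙 ⌊ u ≟ x ⌋ + 𝟙 ⌊ u ≟ y ⌋)
      ≡⟨ cong (degreeSum H P +_) (trans (∑-distrib-+ (λ u → 𝟙 ⌊ u ≟ x ⌋) (λ u → 𝟙 ⌊ u ≟ y ⌋))
                                        (cong₂ _+_ (sum-𝟙-∧-≟ true x) (sum-𝟙-∧-≟ true y))) ⟩
    degreeSum H P + 2 ∎
    where
    open ≤-Reasoning
    pointwise : ∀ u → (if P u then deg G u else 0) ≤ (if P u then deg H u else 0) + (𝟙 ⌊ u ≟ x ⌋ + 𝟙 ⌊ u ≟ y ⌋)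
    pointwise u with P u
    ... | true  = deg-deleteEdge u
    ... | false = z≤n

module Map {n} {H : Graph n} (M : PlanarMap H) where

  open PlanarMap M

  φ : Fin d → Fin d
  φ z = σ (α z)

  α-injective : Injective _≡_ _≡_ α
  α-injective {z} {z'} e = trans (sym (α-invol z)) (trans (cong α e) (α-invol z'))

  φ-injective : Injective _≡_ _≡_ φ
  φ-injective = α-injective ∘ σ-inj

  vertices≤n : orbits σ ≤ n
  vertices≤n = ≤-trans (count-≤-injective (orbitMin σ) (λ _ → true) (λ z _ → tail z) (λ _ _ → refl) injective)
                       (≤-reflexive count-true)
    where
    injective : ∀ {z z'} → orbitMin σ z ≡ true → orbitMin σ z' ≡ true → tail z ≡ tail z' → z ≡ z'
    injective {z} {z'} min min' e with σ-trans z z' e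
    ... | k , σᵏz≡z' = Orbits.orbitMin-unique σ σ-inj k min min' σᵏz≡z'

  σ-fixed⇒deg≤1 : ∀ {z} → σ z ≡ z → deg H (tail z) ≤ 1
  σ-fixed⇒deg≤1 {z} σz≡z = ≤-trans (count-mono (adj H (tail z)) (λ v → ⌊ v ≟ tail (α z) ⌋) only-neighbour)
                                   (≤-reflexive (count-≟ (tail (α z))))
    where
    only-neighbour : ∀ v → adj H (tail z) v ≡ true → ⌊ v ≟ tail (α z) ⌋ ≡ true
    only-neighbour v uv with dart-surj (tail z) v uv
    ... | w , tw≡tz , tαw≡v with σ-trans z w (sym tw≡tz)
    ... | k , σᵏz≡w = ⌊⌋-true (v ≟ tail (α z)) (begin
      v                         ≡⟨ sym tαw≡v ⟩
      tail (α w)                ≡⟨ cong (tail ∘ α) (sym σᵏz≡w) ⟩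
      tail (α (iter σ k z))     ≡⟨ cong (tail ∘ α) (subst (λ j → iter σ j z ≡ z) (*-identityʳ k) (iter-periodic σ σz≡z k)) ⟩
      tail (α z)                ∎)
      where open ≡-Reasoning

  φ²-fixed⇒σ-fixed : ∀ {z} → φ (φ z) ≡ z → σ z ≡ z × σ (α z) ≡ α z
  φ²-fixed⇒σ-fixed {z} φ²z≡z = σz≡z , σαz≡αz
    where
    σαz≡αz : σ (α z) ≡ α z
    σαz≡αz = dart-inj (σ (α z)) (α z) (σ-tail (α z))
      (trans (sym (σ-tail (α (φ z)))) (trans (cong tail φ²z≡z) (cong tail (sym (α-invol z)))))
    σz≡z : σ z ≡ z
    σz≡z = begin
      σ z                 ≡⟨ cong σ (sym (α-invol z)) ⟩
      σ (α (α z))         ≡⟨ cong (σ ∘ α) (sym σαz≡αz) ⟩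
      σ (α (σ (α z)))     ≡⟨ φ²z≡z ⟩
      z                   ∎
      where open ≡-Reasoning

  degreeSum≤darts : ∀ P → degreeSum H P ≤ count (P ∘ tail)
  degreeSum≤darts P = begin
    sum (λ u → if P u then deg H u else 0)               ≤⟨ sum-mono-≤ _ _ pointwise ⟩
    sum (λ u → count (λ z → P (tail z) ∧ ⌊ u ≟ tail z ⌋)) ≡⟨ sym (count-fibres (P ∘ tail) tail) ⟩
    count (P ∘ tail)                                      ∎
    where
    open ≤-Reasoning
    pointwise : ∀ u → (if P u then deg H u else 0) ≤ count (λ z → P (tail z) ∧ ⌊ u ≟ tail z ⌋)
    pointwise u with P u in pu
    ... | false = z≤n
    ... | true  = count-≤-injective (adj H u) _ (λ v uv → proj₁ (dart-surj u v uv)) at-u injective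
      where
      at-u : ∀ v uv → (P (tail (proj₁ (dart-surj u v uv))) ∧ ⌊ u ≟ tail (proj₁ (dart-surj u v uv)) ⌋) ≡ true
      at-u v uv with dart-surj u v uv
      ... | z , refl , _ = cong₂ _∧_ pu (⌊⌋-true (tail z ≟ tail z) refl)
      injective : ∀ {v v'} uv uv' → proj₁ (dart-surj u v uv) ≡ proj₁ (dart-surj u v' uv') → v ≡ v'
      injective {v} {v'} uv uv' e with dart-surj u v uv | dart-surj u v' uv'
      ... | _ , _ , refl | _ , _ , refl = cong (tail ∘ α) e

module BipartiteMap {n} {H : Graph n} (M : PlanarMap H) (inA : Fin n → Bool) (bip : IsBipartition H inA) where

  open PlanarMap M
  open Map M

  colour-α : ∀ z → inA (tail (α z)) ≡ not (inA (tail z))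
  colour-α z = Bool.¬-not (λ e → true≢false (trans (sym (dart-edge z)) (bip _ _ (sym e))))
    where
    true≢false : true ≢ false
    true≢false ()

  colour-φ : ∀ z → inA (tail (φ z)) ≡ not (inA (tail z))
  colour-φ z = trans (cong inA (σ-tail (α z))) (colour-α z)

  colour-φ² : ∀ z → inA (tail (φ (φ z))) ≡ inA (tail z)
  colour-φ² z = trans (colour-φ (φ z)) (trans (cong not (colour-φ z)) (Bool.not-involutive _))

  darts≤2*A-darts : d ≤ count (inA ∘ tail) + count (inA ∘ tail)
  darts≤2*A-darts = begin
    d                                                 ≡⟨ sym (count-complement (inA ∘ tail)) ⟩
    count (inA ∘ tail) + count (not ∘ inA ∘ tail)     ≤⟨ +-monoʳ-≤ (count (inA ∘ tail)) B-darts≤A-darts ⟩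
    count (inA ∘ tail) + count (inA ∘ tail)           ∎
    where
    open ≤-Reasoning
    B-darts≤A-darts : count (not ∘ inA ∘ tail) ≤ count (inA ∘ tail)
    B-darts≤A-darts = count-≤-injective (not ∘ inA ∘ tail) (inA ∘ tail) (λ z _ → α z)
                        (λ z b → trans (colour-α z) b) (λ _ _ → α-injective)

  A-darts≤edges : count (inA ∘ tail) ≤ orbits α
  A-darts≤edges = Involution.count≤orbits α α-invol (inA ∘ tail) (λ z a → trans (colour-α z) (cong not a))

  faces≥4 : (∀ u → inA u ≡ true → 2 ≤ deg H u) → NoShortCycles φ 4
  faces≥4 A-deg≥2 1 z _ _ φz≡z = Bool.not-¬ refl (trans (cong (inA ∘ tail) (sym φz≡z)) (colour-φ z))
  faces≥4 A-deg≥2 2 z _ _ φ²z≡z with inA (tail z) in a | φ²-fixed⇒σ-fixed φ²z≡z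
  ... | true  | σz≡z , _      = ≤⇒≯ (σ-fixed⇒deg≤1 σz≡z) (A-deg≥2 (tail z) a)
  ... | false | _ , σαz≡αz    = ≤⇒≯ (σ-fixed⇒deg≤1 σαz≡αz) (A-deg≥2 (tail (α z)) (trans (colour-α z) (cong not a)))
  faces≥4 A-deg≥2 3 z _ _ φ³z≡z = Bool.not-¬ refl
    (trans (cong (inA ∘ tail) (sym φ³z≡z)) (trans (colour-φ (φ (φ z))) (cong not (colour-φ² z))))
  faces≥4 A-deg≥2 (suc (suc (suc (suc _)))) _ _ (s≤s (s≤s (s≤s (s≤s ()))))

  4*faces≤darts : (∀ u → inA u ≡ true → 2 ≤ deg H u) → 4 * orbits φ ≤ d
  4*faces≤darts A-deg≥2 = Orbits.*-orbits≤ φ φ-injective 4 (faces≥4 A-deg≥2)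

euler-contradiction : ∀ {a D V E F C} → V ≤ a + a → 4 * F ≤ D + D → D ≤ E → 1 ≤ C → 4 * a ≤ D + 2 →
                      V + F ≡ E + 2 * C → ⊥
euler-contradiction {a} {D} {V} {E} {F} {C} V≤2a 4F≤2D D≤E 1≤C 4a≤D+2 euler =
  8≰4 (+-cancelˡ-≤ (4 * E) 8 4 (begin
    4 * E + 8                         ≤⟨ +-monoʳ-≤ (4 * E) (*-monoʳ-≤ 8 1≤C) ⟩
    4 * E + 8 * C                     ≡⟨ factor E C ⟩
    4 * (E + 2 * C)                   ≡⟨ cong (4 *_) (sym euler) ⟩
    4 * (V + F)                       ≡⟨ *-distribˡ-+ 4 V F ⟩
    4 * V + 4 * F                     ≤⟨ +-mono-≤ (*-monoʳ-≤ 4 V≤2a) 4F≤2D ⟩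
    4 * (a + a) + (D + D)             ≡⟨ cong (_+ (D + D)) (*-distribˡ-+ 4 a a) ⟩
    (4 * a + 4 * a) + (D + D)         ≤⟨ +-monoˡ-≤ (D + D) (+-mono-≤ 4a≤D+2 4a≤D+2) ⟩
    (D + 2 + (D + 2)) + (D + D)       ≡⟨ collect D ⟩
    4 * D + 4                         ≤⟨ +-monoˡ-≤ 4 (*-monoʳ-≤ 4 D≤E) ⟩
    4 * E + 4                         ∎))
  where
  open ≤-Reasoning
  8≰4 : ¬ 8 ≤ 4
  8≰4 (s≤s (s≤s (s≤s (s≤s ()))))
  factor : ∀ e c → 4 * e + 8 * c ≡ 4 * (e + 2 * c)
  factor = solve-∀
  collect : ∀ t → (t + 2 + (t + 2)) + (t + t) ≡ 4 * t + 4
  collect = solve-∀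

¬A-deg≥4 : ∀ {n} (G : Graph n) (x y : Fin n) → Planar (deleteEdge G x y) →
           (inA : Fin n → Bool) → IsBipartition (deleteEdge G x y) inA →
           count (not ∘ inA) ≤ count inA → 0 < count inA →
           ¬ (∀ v → inA v ≡ true → 4 ≤ deg G v)
¬A-deg≥4 G x y M inA bip B≤A 0<a A-deg≥4 =
  euler-contradiction {a} {DA} V≤2a (≤-trans (4*faces≤darts A-deg≥2) darts≤2*A-darts) A-darts≤edges
    (components-pos α σ 0<d) 4a≤DA+2 euler
  where
  H = deleteEdge G x y
  open PlanarMap M
  open Map M
  open BipartiteMap M inA bip
  a = count inA
  DA = count (inA ∘ tail)
  A-deg≥2 : ∀ u → inA u ≡ true → 2 ≤ deg H u
  A-deg≥2 u u∈A = +-cancelʳ-≤ 2 2 (deg H u) (≤-trans (A-deg≥4 u u∈A) (deg≤deg-deleteEdge+2 G x y u))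
  V≤2a : orbits σ ≤ a + a
  V≤2a = ≤-trans vertices≤n (≤-trans (≤-reflexive (sym (count-complement inA))) (+-monoʳ-≤ a B≤A))
  4a≤DA+2 : 4 * a ≤ DA + 2
  4a≤DA+2 = begin
    4 * a                 ≤⟨ *-count≤sum 4 inA (deg G) A-deg≥4 ⟩
    degreeSum G inA       ≤⟨ degreeSum-deleteEdge G x y inA ⟩
    degreeSum H inA + 2   ≤⟨ +-monoˡ-≤ 2 (degreeSum≤darts inA) ⟩
    DA + 2                ∎
    where open ≤-Reasoning
  0<d : 0 < d
  0<d = ≤-trans (s≤s z≤n) (≤-trans 2≤DA (count≤n (inA ∘ tail)))
    where
    2≤DA : 2 ≤ DA
    2≤DA = +-cancelʳ-≤ 2 2 DA (≤-trans (*-monoʳ-≤ 4 0<a) 4a≤DA+2)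

lemma7 : ∀ {n} (G : Graph n) (x y : Fin n) → adj G x y ≡ true →
         Planar (deleteEdge G x y) →
         (inA : Fin n → Bool) → IsBipartition (deleteEdge G x y) inA →
         count (λ v → not (inA v)) ≤ count inA →
         count inA ≤ count (λ v → not (inA v)) + 1 →
         inA x ≡ true → inA y ≡ true →
         Σ (Fin n) (λ v → (inA v ≡ true) × (deg G v ≤ 3))
lemma7 G x y _ M inA bip B≤A _ x∈A _ with any? (λ v → (inA v Bool.≟ true) ×-dec (deg G v ≤? 3))
... | yes (v , v∈A , deg≤3) = v , v∈A , deg≤3
... | no ∄v = ⊥-elim (¬A-deg≥4 G x y M inA bip B≤A (count-pos inA x∈A)
                        (λ v v∈A → ≰⇒> (λ deg≤3 → ∄v (v , v∈A , deg≤3))))
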